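{- Let $\langle A,f,g\rangle$ be a PS-algebra satisfying, for all $x,y,z\in A$, $x\le f(x,x)$, $y\cdot f(x,z)\le f(x\cdot f(x,y),z)$, and $f(x,g(x,-y)\cdot y)\le y$. Then the map $d:A\to A$, $d(a)=f(a,a)+-g(a,a)$, is the unary discriminator on $A$ (i.e., $d(0)=0$ and $d(a)=1$ for $a\ne 0$) if and only if $g(a,a)\le a$ for every $a\neq 0$.
   Context: $A$ is a non-trivial Boolean algebra ($+,\cdot,-,0,1$). A PS-algebra $\langle A,f,g\rangle$ has $f:A^2\to A$ with $f(0,y)=f(x,0)=0$ and additive in each argument, and $g:A^2\to A$ with $g(0,y)=g(x,0)=1$, $g(x+x',y)=g(x,y)\cdot g(x',y)$ and $g(x,y+y')=g(x,y)\cdot g(x,y')$. -}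

module Defs where

open import Level using (Level)
open import Data.Product using (_×_)
open import Relation.Nullary using (¬_)
open import Algebra.Lattice.Bundles using (BooleanAlgebra)

module _ {c ℓ : Level} (B : BooleanAlgebra c ℓ) where
  open BooleanAlgebra B renaming (¬_ to -_)

  _≤ᴮ_ : Carrier → Carrier → Set ℓ
  x ≤ᴮ y = (x ∧ y) ≈ x

  NonTrivial : Set ℓ
  NonTrivial = ¬ (⊤ ≈ ⊥)

  Congruent₂ : (Carrier → Carrier → Carrier) → Set _
  Congruent₂ h = ∀ {x x' y y'} → x ≈ x' → y ≈ y' → h x y ≈ h x' y'

  record IsPSAlgebra (f g : Carrier → Carrier → Carrier) : Set (c Level.⊔ ℓ) where
    field
      f-cong  : Congruent₂ f
      g-cong  : Congruent₂ g
      f-0ˡ    : ∀ y → f ⊥ y ≈ ⊥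
      f-0ʳ    : ∀ x → f x ⊥ ≈ ⊥
      f-addˡ  : ∀ x x' y → f (x ∨ x') y ≈ (f x y ∨ f x' y)
      f-addʳ  : ∀ x y y' → f x (y ∨ y') ≈ (f x y ∨ f x y')
      g-0ˡ    : ∀ y → g ⊥ y ≈ ⊤
      g-0ʳ    : ∀ x → g x ⊥ ≈ ⊤
      g-multˡ : ∀ x x' y → g (x ∨ x') y ≈ (g x y ∧ g x' y)
      g-multʳ : ∀ x y y' → g x (y ∨ y') ≈ (g x y ∧ g x y')

  IsUnaryDiscriminator : (Carrier → Carrier) → Set (c Level.⊔ ℓ)
  IsUnaryDiscriminator d = (d ⊥ ≈ ⊥) × (∀ a → ¬ (a ≈ ⊥) → d a ≈ ⊤)

{-# OPTIONS --safe #-}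
-- Write F = f(a,a) and G = g(a,a).  In a Boolean algebra d(a) = F + -G is 1 exactly
-- when G ≤ F, and the first axiom gives a ≤ F, so G ≤ a suffices.  Conversely the
-- second and third axioms force G · F ≤ a: for C = G · -a the third axiom puts
-- f(a,C) below -a, so a · f(a,C) = 0 and the second axiom gives C · F ≤ f(0,a) = 0.
-- Hence G ≤ F implies G = G · F ≤ a.
module Submission where

open import Defs
open import Level using (Level)
open import Function.Bundles using (_⇔_; mk⇔; Equivalence)
open import Relation.Nullary using (¬_)
open import Algebra.Lattice.Bundles using (BooleanAlgebra)
open import Data.Product using (_,_; proj₂)
import Algebra.Lattice.Properties.BooleanAlgebra as BooleanAlgebraProperties
import Relation.Binary.Reasoning.Setoid as SetoidReasoning

module BooleanOrder {c ℓ : Level} (B : BooleanAlgebra c ℓ) where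
  open BooleanAlgebra B renaming (¬_ to -_)
  open BooleanAlgebraProperties B
  open SetoidReasoning setoid

  infix 4 _≤_
  _≤_ : Carrier → Carrier → Set ℓ
  _≤_ = _≤ᴮ_ B

  ≤-trans : ∀ {x y z} → x ≤ y → y ≤ z → x ≤ z
  ≤-trans {x} {y} {z} x≤y y≤z = begin
    x ∧ z       ≈⟨ ∧-congʳ (sym x≤y) ⟩
    (x ∧ y) ∧ z ≈⟨ ∧-assoc x y z ⟩
    x ∧ (y ∧ z) ≈⟨ ∧-congˡ y≤z ⟩
    x ∧ y       ≈⟨ x≤y ⟩
    x           ∎

  ≤-respˡ-≈ : ∀ {x x′ y} → x ≈ x′ → x ≤ y → x′ ≤ y
  ≤-respˡ-≈ {x} {x′} {y} x≈x′ x≤y = begin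
    x′ ∧ y ≈⟨ ∧-congʳ (sym x≈x′) ⟩
    x ∧ y  ≈⟨ x≤y ⟩
    x      ≈⟨ x≈x′ ⟩
    x′     ∎

  ≤⇒∨¬≈⊤ : ∀ {x y} → x ≤ y → (y ∨ - x) ≈ ⊤
  ≤⇒∨¬≈⊤ {x} {y} x≤y = begin
    y ∨ - x           ≈⟨ ∨-congʳ (sym y∨x≈y) ⟩
    (y ∨ x) ∨ - x     ≈⟨ ∨-assoc y x (- x) ⟩
    y ∨ (x ∨ - x)     ≈⟨ ∨-congˡ (∨-complementʳ x) ⟩
    y ∨ ⊤             ≈⟨ ∨-zeroʳ y ⟩
    ⊤                 ∎
    where
    y∨x≈y : (y ∨ x) ≈ y
    y∨x≈y = begin
      y ∨ x       ≈⟨ ∨-congˡ (sym x≤y) ⟩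
      y ∨ (x ∧ y) ≈⟨ ∨-congˡ (∧-comm x y) ⟩
      y ∨ (y ∧ x) ≈⟨ ∨-absorbs-∧ y x ⟩
      y           ∎

  ∨¬≈⊤⇒≤ : ∀ {x y} → (y ∨ - x) ≈ ⊤ → x ≤ y
  ∨¬≈⊤⇒≤ {x} {y} y∨¬x≈⊤ = sym (begin
    x                       ≈⟨ sym (∧-identityʳ x) ⟩
    x ∧ ⊤                   ≈⟨ ∧-congˡ (sym y∨¬x≈⊤) ⟩
    x ∧ (y ∨ - x)           ≈⟨ ∧-distribˡ-∨ x y (- x) ⟩
    (x ∧ y) ∨ (x ∧ - x)     ≈⟨ ∨-congˡ (∧-complementʳ x) ⟩
    (x ∧ y) ∨ ⊥             ≈⟨ ∨-identityʳ (x ∧ y) ⟩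
    x ∧ y                   ∎)

  ∧¬≈⊥⇒≤ : ∀ {x y} → (x ∧ - y) ≈ ⊥ → x ≤ y
  ∧¬≈⊥⇒≤ {x} {y} x∧¬y≈⊥ = sym (begin
    x                       ≈⟨ sym (∧-identityʳ x) ⟩
    x ∧ ⊤                   ≈⟨ ∧-congˡ (sym (∨-complementʳ y)) ⟩
    x ∧ (y ∨ - y)           ≈⟨ ∧-distribˡ-∨ x y (- y) ⟩
    (x ∧ y) ∨ (x ∧ - y)     ≈⟨ ∨-congˡ x∧¬y≈⊥ ⟩
    (x ∧ y) ∨ ⊥             ≈⟨ ∨-identityʳ (x ∧ y) ⟩
    x ∧ y                   ∎)

  ≤¬⇒∧≈⊥ : ∀ {x y} → x ≤ - y → (y ∧ x) ≈ ⊥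
  ≤¬⇒∧≈⊥ {x} {y} x≤¬y = begin
    y ∧ x           ≈⟨ ∧-congˡ (sym x≤¬y) ⟩
    y ∧ (x ∧ - y)   ≈⟨ ∧-congˡ (∧-comm x (- y)) ⟩
    y ∧ (- y ∧ x)   ≈⟨ sym (∧-assoc y (- y) x) ⟩
    (y ∧ - y) ∧ x   ≈⟨ ∧-congʳ (∧-complementʳ y) ⟩
    ⊥ ∧ x           ≈⟨ ∧-zeroˡ x ⟩
    ⊥               ∎

module PSAlgebra {c ℓ : Level} (B : BooleanAlgebra c ℓ)
  (f g : BooleanAlgebra.Carrier B → BooleanAlgebra.Carrier B → BooleanAlgebra.Carrier B)
  (ps : IsPSAlgebra B f g) where
  open BooleanAlgebra B renaming (¬_ to -_)
  open BooleanAlgebraProperties B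
  open IsPSAlgebra ps
  open BooleanOrder B
  open SetoidReasoning setoid

  discriminator : Carrier → Carrier
  discriminator a = f a a ∨ - g a a

  discriminator-⊥ : discriminator ⊥ ≈ ⊥
  discriminator-⊥ = begin
    f ⊥ ⊥ ∨ - g ⊥ ⊥ ≈⟨ ∨-cong (f-0ˡ ⊥) (¬-cong (g-0ˡ ⊥)) ⟩
    ⊥ ∨ - ⊤         ≈⟨ ∨-identityˡ (- ⊤) ⟩
    - ⊤             ≈⟨ ¬⊤≈⊥ ⟩
    ⊥               ∎

  discriminator≈⊤⇔g≤f : ∀ a → discriminator a ≈ ⊤ ⇔ g a a ≤ f a a
  discriminator≈⊤⇔g≤f a = mk⇔ ∨¬≈⊤⇒≤ ≤⇒∨¬≈⊤

  module _ (f-contraction : ∀ x y → f x (g x (- y) ∧ y) ≤ y) where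

    f-g-complement-≤ : ∀ x y → f x (g x y ∧ - y) ≤ - y
    f-g-complement-≤ x y =
      ≤-respˡ-≈ (f-cong refl (∧-congʳ (g-cong refl (¬-involutive y))))
                (f-contraction x (- y))

    module _ (f-shift : ∀ x y z → (y ∧ f x z) ≤ f (x ∧ f x y) z) where

      g∧f≤ : ∀ a → (g a a ∧ f a a) ≤ a
      g∧f≤ a = ∧¬≈⊥⇒≤ (begin
        (g a a ∧ f a a) ∧ - a   ≈⟨ ∧-assoc (g a a) (f a a) (- a) ⟩
        g a a ∧ (f a a ∧ - a)   ≈⟨ ∧-congˡ (∧-comm (f a a) (- a)) ⟩
        g a a ∧ (- a ∧ f a a)   ≈⟨ sym (∧-assoc (g a a) (- a) (f a a)) ⟩
        C ∧ f a a               ≈⟨ sym (f-shift a C a) ⟩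
        (C ∧ f a a) ∧ f (a ∧ f a C) a
          ≈⟨ ∧-congˡ (f-cong (≤¬⇒∧≈⊥ (f-g-complement-≤ a a)) refl) ⟩
        (C ∧ f a a) ∧ f ⊥ a     ≈⟨ ∧-congˡ (f-0ˡ a) ⟩
        (C ∧ f a a) ∧ ⊥         ≈⟨ ∧-zeroʳ (C ∧ f a a) ⟩
        ⊥                       ∎)
        where
        C : Carrier
        C = g a a ∧ - a

      g≤f⇒g≤ : ∀ a → g a a ≤ f a a → g a a ≤ a
      g≤f⇒g≤ a g≤f = ≤-respˡ-≈ g≤f (g∧f≤ a)

theorem6p14 : {c ℓ : Level} (B : BooleanAlgebra c ℓ) → NonTrivial B →
    (f g : BooleanAlgebra.Carrier B → BooleanAlgebra.Carrier B → BooleanAlgebra.Carrier B) →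
    IsPSAlgebra B f g →
    (∀ x → _≤ᴮ_ B x (f x x)) →
    (∀ x y z → _≤ᴮ_ B (BooleanAlgebra._∧_ B y (f x z)) (f (BooleanAlgebra._∧_ B x (f x y)) z)) →
    (∀ x y → _≤ᴮ_ B (f x (BooleanAlgebra._∧_ B (g x (BooleanAlgebra.¬_ B y)) y)) y) →
    (IsUnaryDiscriminator B (λ a → BooleanAlgebra._∨_ B (f a a) (BooleanAlgebra.¬_ B (g a a)))
    ⇔ (∀ a → ¬ (BooleanAlgebra._≈_ B a (BooleanAlgebra.⊥ B)) → _≤ᴮ_ B (g a a) a))
theorem6p14 B _ f g ps x≤fxx f-shift f-contraction = mk⇔
  (λ d a a≉⊥ → g≤f⇒g≤ f-contraction f-shift a (to (discriminator≈⊤⇔g≤f a) (proj₂ d a a≉⊥)))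
  (λ g≤ → discriminator-⊥ , λ a a≉⊥ →
    from (discriminator≈⊤⇔g≤f a) (≤-trans (g≤ a a≉⊥) (x≤fxx a)))
  where
  open BooleanOrder B
  open PSAlgebra B f g ps
  open Equivalence
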